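{- Let $G$ be a graph and $a,b,c\in V(G)$ distinct. Let $\mathcal{P}_{a,b}$ be a family of $\aleph_0$ pairwise edge-disjoint, pairwise order-compatible $a{ - }b$ paths, and $\mathcal{P}_{b,c}$ a family of $\aleph_0$ pairwise edge-disjoint, pairwise order-compatible $b{ - }c$ paths. Let $\mathcal{P}\subseteq\mathcal{P}_{a,b}$ and $\mathcal{Q}\subseteq\mathcal{P}_{b,c}$ be infinite subfamilies. If there is no pair of infinite subfamilies $\mathcal{P}'\subseteq\mathcal{P}$, $\mathcal{Q}'\subseteq\mathcal{Q}$ admitting a $(\mathcal{P}',\mathcal{Q}')$-terminal, then there exists a family of $\aleph_0$ pairwise edge-disjoint, pairwise order-compatible $a{ - }c$ paths in $G$.
   Context: Graphs may have parallel edges but no loops. Two $x{ - }y$ paths are order-compatible if their common vertices occur in the same order when travelling along each from $x$ to $y$. For $\mathcal{P}'\subseteq\mathcal{P}_{a,b}$ and $\mathcal{Q}'\subseteq\mathcal{P}_{b,c}$, a vertex $v$ is a $(\mathcal{P}',\mathcal{Q}')$-terminal if $v$ lies on some path of $\mathcal{P}'$, $v$ lies on every path $Q\in\mathcal{Q}'$, and for every $Q\in\mathcal{Q}'$ the subpath $vQc$ of $Q$ from $v$ to $c$ meets $\bigcup\mathcal{P}'$ only in $v$. -}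

module Defs where

open import Level using (Level; 0ℓ) renaming (suc to lsuc)
open import Data.Nat using (ℕ; _≤_; _<_)
open import Data.Product using (Σ; ∃; ∃-syntax; _×_; _,_)
open import Data.Sum using (_⊎_)
open import Data.List using (List; []; _∷_; length; lookup)
open import Data.List.Membership.Propositional using (_∈_)
open import Data.List.Relation.Unary.Unique.Propositional using (Unique)
open import Data.Fin using (Fin; toℕ)
open import Relation.Binary.PropositionalEquality using (_≡_; _≢_)
open import Relation.Nullary using (¬_)
open import Function.Bundles using (_⇔_)

-- A multigraph (parallel edges allowed, no loops), possibly infinite.
record Graph : Set₁ where
  field
    V    : Set
    E    : Set
    end₁ : E → V
    end₂ : E → V
    noLoop : ∀ e → end₁ e ≢ end₂ e

module _ (G : Graph) where
  open Graph G

  Joins : E → V → V → Set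
  Joins e u v = (end₁ e ≡ u × end₂ e ≡ v) ⊎ (end₁ e ≡ v × end₂ e ≡ u)

  data Walk : V → V → Set where
    nil  : ∀ {x} → Walk x x
    cons : ∀ {x z y} (e : E) → Joins e x z → Walk z y → Walk x y

  verts : ∀ {x y} → Walk x y → List V
  verts {x} nil = x ∷ []
  verts {x} (cons e _ w) = x ∷ verts w

  edges : ∀ {x y} → Walk x y → List E
  edges nil = []
  edges (cons e _ w) = e ∷ edges w

  record Path (x y : V) : Set where
    constructor mkPath
    field
      walk     : Walk x y
      distinct : Unique (verts walk)
  open Path public

  _on_ : ∀ {x y} → V → Path x y → Set
  v on P = v ∈ verts (walk P)

  Before : ∀ {x y} → Path x y → V → V → Set
  Before P u v = Σ (Fin (length (verts (walk P)))) λ i →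
                 Σ (Fin (length (verts (walk P)))) λ j →
                 toℕ i < toℕ j × lookup (verts (walk P)) i ≡ u × lookup (verts (walk P)) j ≡ v

  EdgeDisjoint : ∀ {x y} → Path x y → Path x y → Set
  EdgeDisjoint P Q = ∀ e → e ∈ edges (walk P) → ¬ (e ∈ edges (walk Q))

  OrderCompatible : ∀ {x y} → Path x y → Path x y → Set
  OrderCompatible P Q = ∀ u v → u on P → v on P → u on Q → v on Q →
                        Before P u v ⇔ Before Q u v

  -- a family of ℵ₀ pairwise edge-disjoint, pairwise order-compatible x–y paths,
  -- indexed by ℕ (distinct indices give distinct paths, by edge-disjointness
  -- of paths with at least one edge; x ≢ y in all uses)
  record GoodFamily (x y : V) : Set where
    field
      path    : ℕ → Path x y
      disj    : ∀ i j → i ≢ j → EdgeDisjoint (path i) (path j)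
      compat  : ∀ i j → i ≢ j → OrderCompatible (path i) (path j)
  open GoodFamily public

-- subfamilies are given by sets of indices
Infinite : (ℕ → Set) → Set
Infinite S = ∀ n → ∃[ m ] (n ≤ m × S m)

_⊆ᵢ_ : (ℕ → Set) → (ℕ → Set) → Set
S ⊆ᵢ T = ∀ i → S i → T i

module _ (G : Graph) where
  open Graph G

  -- v is a (𝒫',𝒬')-terminal, where 𝒫' = {𝒫 i | i ∈ S}, 𝒬' = {𝒬 j | j ∈ T}
  IsTerminal : ∀ {a b c} → GoodFamily G a b → GoodFamily G b c →
               (ℕ → Set) → (ℕ → Set) → V → Set
  IsTerminal 𝒫 𝒬 S T v =
      (∃[ i ] (S i × _on_ G v (path 𝒫 i)))
    × (∀ j → T j → _on_ G v (path 𝒬 j))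
    × (∀ j → T j → ∀ w → Before G (path 𝒬 j) v w →
         ¬ (∃[ i ] (S i × _on_ G w (path 𝒫 i))))

{-# OPTIONS --safe #-}
module Submission where

-- Let U be the set of vertices lying on the paths 𝒫ab i with i ∈ S. Every 𝒫bc j starts
-- at b ∈ U; cut it at its last vertex v j in U, which lies on some 𝒫ab (i j), and glue
-- the a–v j part of 𝒫ab (i j) to the v j–c part of 𝒫bc j.  The glued walk is a path,
-- since its first part lies in U and its second part avoids U after v j.  If infinitely
-- many j ∈ T shared one v j, that vertex would be a terminal for S and those j; so every
-- vertex is some v j for only finitely many j ∈ T, and as paths are finite one can pick
-- j₀ < j₁ < … in T with pairwise distinct i's.  Two glued paths then inherit
-- edge-disjointness and order-compatibility piecewise from the two families, because
-- membership in U tells on which side of the junction a vertex lies, and an edge of a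
-- U-part has both ends in U while an edge after a junction has an end outside U.

open import Defs
open import Level using (Level; 0ℓ)
open import Axiom.ExcludedMiddle using (ExcludedMiddle)
open import Data.Nat using (ℕ; zero; suc; _≤_; _<_; _≤′_; _⊔_; z≤n; s≤s; ≤′-refl; ≤′-step)
open import Data.Nat.Properties
  using (<-cmp; <⇒≢; <⇒≤; ≤-refl; ≤-trans; ≤⇒≤′; m≤m⊔n; m≤n⊔m; m⊔n≤o⇒m≤o; m⊔n≤o⇒n≤o)
open import Data.Product using (Σ; ∃; ∃-syntax; _×_; _,_; proj₁; proj₂)
open import Data.Sum using (_⊎_; inj₁; inj₂)
open import Data.Empty using (⊥-elim)
open import Data.Fin using (Fin; toℕ; zero; suc)
open import Data.List using (List; []; _∷_; _++_; length; lookup)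
open import Data.List.Membership.Propositional using (_∈_; _∉_; lose)
open import Data.List.Membership.Propositional.Properties using (∈-++⁺ˡ; ∈-++⁺ʳ; ∈-++⁻; ∈-lookup)
open import Data.List.Relation.Unary.All using (All; []; _∷_)
import Data.List.Relation.Unary.All as All
open import Data.List.Relation.Unary.All.Properties using (All¬⇒¬Any; ¬Any⇒All¬)
import Data.List.Relation.Unary.All.Properties as All
open import Data.List.Relation.Unary.Any using (Any; here; there; index; any?)
open import Data.List.Relation.Unary.Any.Properties using (lookup-index)
open import Data.List.Relation.Unary.Unique.Propositional using (Unique; []; _∷_)
import Data.List.Relation.Unary.Unique.Propositional.Properties as Unique
open import Relation.Binary using (tri<; tri≈; tri>)
open import Relation.Binary.PropositionalEquality
  using (_≡_; _≢_; ≢-sym; refl; sym; trans; cong; subst; subst₂)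
open import Relation.Nullary using (¬_; yes; no)
open import Relation.Unary using (Decidable)
open import Function.Base using (_∘_)
open import Function.Bundles using (_⇔_; mk⇔; Equivalence)
open import Function.Construct.Symmetry using (⇔-sym)

module _ {a} {A : Set a} where

  open import Data.List.Relation.Binary.Disjoint.Propositional {A = A} using (Disjoint)

  data Precedes : List A → A → A → Set a where
    here  : ∀ {u v xs} → v ∈ xs → Precedes (u ∷ xs) u v
    there : ∀ {x u v xs} → Precedes xs u v → Precedes (x ∷ xs) u v

  PrecedesAt : List A → A → A → Set a
  PrecedesAt xs u v = Σ (Fin (length xs)) λ i → Σ (Fin (length xs)) λ j →
                      toℕ i < toℕ j × lookup xs i ≡ u × lookup xs j ≡ v

  precedes⇔precedesAt : ∀ {xs u v} → Precedes xs u v ⇔ PrecedesAt xs u v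
  precedes⇔precedesAt = mk⇔ to (from _)
    where
    to : ∀ {xs u v} → Precedes xs u v → PrecedesAt xs u v
    to (here v∈xs) = zero , suc (index v∈xs) , s≤s z≤n , refl , sym (lookup-index v∈xs)
    to (there p) with i , j , i<j , eqᵢ , eqⱼ ← to p = suc i , suc j , s≤s i<j , eqᵢ , eqⱼ

    from : ∀ xs {u v} → PrecedesAt xs u v → Precedes xs u v
    from (x ∷ xs) (zero , suc j , _ , refl , refl) = here (∈-lookup j)
    from (x ∷ xs) (suc i , suc j , s≤s i<j , eqᵢ , eqⱼ) =
      there (from xs (i , j , i<j , eqᵢ , eqⱼ))

  precedes⇒∈ : ∀ {xs u v} → Precedes xs u v → u ∈ xs × v ∈ xs
  precedes⇒∈ (here v∈xs) = here refl , there v∈xs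
  precedes⇒∈ (there p) with u∈ , v∈ ← precedes⇒∈ p = there u∈ , there v∈

  precedes-++⁺ˡ : ∀ {xs ys u v} → Precedes xs u v → Precedes (xs ++ ys) u v
  precedes-++⁺ˡ (here v∈xs) = here (∈-++⁺ˡ v∈xs)
  precedes-++⁺ˡ (there p) = there (precedes-++⁺ˡ p)

  precedes-++⁺ʳ : ∀ xs {ys u v} → Precedes ys u v → Precedes (xs ++ ys) u v
  precedes-++⁺ʳ [] p = p
  precedes-++⁺ʳ (x ∷ xs) p = there (precedes-++⁺ʳ xs p)

  precedes-++⁺ : ∀ {xs ys u v} → u ∈ xs → v ∈ ys → Precedes (xs ++ ys) u v
  precedes-++⁺ {_ ∷ xs} (here refl) v∈ys = here (∈-++⁺ʳ xs v∈ys)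
  precedes-++⁺ (there u∈xs) v∈ys = there (precedes-++⁺ u∈xs v∈ys)

  precedes-++⁻ : ∀ xs {ys u v} → Precedes (xs ++ ys) u v →
                 Precedes xs u v ⊎ (u ∈ xs × v ∈ ys) ⊎ Precedes ys u v
  precedes-++⁻ [] p = inj₂ (inj₂ p)
  precedes-++⁻ (x ∷ xs) (here v∈) with ∈-++⁻ xs v∈
  ... | inj₁ v∈xs = inj₁ (here v∈xs)
  ... | inj₂ v∈ys = inj₂ (inj₁ (here refl , v∈ys))
  precedes-++⁻ (x ∷ xs) (there p) with precedes-++⁻ xs p
  ... | inj₁ q = inj₁ (there q)
  ... | inj₂ (inj₁ (u∈xs , v∈ys)) = inj₂ (inj₁ (there u∈xs , v∈ys))
  ... | inj₂ (inj₂ q) = inj₂ (inj₂ q)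

  precedes-++⁻ˡ : ∀ xs {ys u v} → Disjoint xs ys → v ∈ xs →
                  Precedes (xs ++ ys) u v → Precedes xs u v
  precedes-++⁻ˡ xs xs#ys v∈xs p with precedes-++⁻ xs p
  ... | inj₁ q = q
  ... | inj₂ (inj₁ (_ , v∈ys)) = ⊥-elim (xs#ys (v∈xs , v∈ys))
  ... | inj₂ (inj₂ q) = ⊥-elim (xs#ys (v∈xs , proj₂ (precedes⇒∈ q)))

  precedes-++⁻ʳ : ∀ xs {ys u v} → Disjoint xs ys → u ∈ ys →
                  Precedes (xs ++ ys) u v → Precedes ys u v
  precedes-++⁻ʳ xs xs#ys u∈ys p with precedes-++⁻ xs p
  ... | inj₁ q = ⊥-elim (xs#ys (proj₁ (precedes⇒∈ q) , u∈ys))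
  ... | inj₂ (inj₁ (u∈xs , _)) = ⊥-elim (xs#ys (u∈xs , u∈ys))
  ... | inj₂ (inj₂ q) = q

  unique-++⁻ : ∀ xs {ys} → Unique (xs ++ ys) → Unique xs × Unique ys × Disjoint xs ys
  unique-++⁻ [] u = [] , u , λ ()
  unique-++⁻ (x ∷ xs) (x∉ ∷ u) with uxs , uys , xs#ys ← unique-++⁻ xs u =
    All.++⁻ˡ xs x∉ ∷ uxs , uys , λ where
      (here refl , v∈ys) → All¬⇒¬Any (All.++⁻ʳ xs x∉) v∈ys
      (there v∈xs , v∈ys) → xs#ys (v∈xs , v∈ys)

  precedes-after : ∀ xs {v ys w} → Unique (xs ++ v ∷ ys) →
                   Precedes (xs ++ v ∷ ys) v w → w ∈ ys
  precedes-after xs {v} {ys} u p with _ , v∷ys-unique , xs#v∷ys ← unique-++⁻ xs {v ∷ ys} u =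
    after v∷ys-unique (precedes-++⁻ʳ xs xs#v∷ys (here refl) p)
    where
    after : ∀ {w} → Unique (v ∷ ys) → Precedes (v ∷ ys) v w → w ∈ ys
    after _ (here w∈ys) = w∈ys
    after (v∉ys ∷ _) (there q) = ⊥-elim (All¬⇒¬Any v∉ys (proj₁ (precedes⇒∈ q)))

  OrderPreserved : List A → List A → Set a
  OrderPreserved xs ys = ∀ {u v} → u ∈ ys → v ∈ ys → Precedes xs u v → Precedes ys u v

  module _ {ℓ} (U : A → Set ℓ) where

    ∈-++-inside : ∀ xs {ys z} → All (¬_ ∘ U) ys → z ∈ xs ++ ys → U z → z ∈ xs
    ∈-++-inside xs ys∌U z∈ Uz with ∈-++⁻ xs z∈
    ... | inj₁ z∈xs = z∈xs
    ... | inj₂ z∈ys = ⊥-elim (All.lookup ys∌U z∈ys Uz)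

    ∈-++-outside : ∀ xs {ys z} → All U xs → z ∈ xs ++ ys → ¬ U z → z ∈ ys
    ∈-++-outside xs xs⊆U z∈ ¬Uz with ∈-++⁻ xs z∈
    ... | inj₁ z∈xs = ⊥-elim (¬Uz (All.lookup xs⊆U z∈xs))
    ... | inj₂ z∈ys = z∈ys

    -- U tells on which side of C′ ++ B′ a vertex lies.  A pair inside C (inside B) is
    -- ordered through C ++ D (E ++ B) and cut back to C′ (B′) by disjointness.
    order-preserved-++ : ∀ {C D E B C′ D′ E′ B′} →
      All U C → All U C′ → All (¬_ ∘ U) B → All (¬_ ∘ U) B′ →
      Disjoint C′ D′ → Disjoint E′ B′ →
      OrderPreserved (C ++ D) (C′ ++ D′) → OrderPreserved (E ++ B) (E′ ++ B′) →
      OrderPreserved (C ++ B) (C′ ++ B′)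
    order-preserved-++ {C} {E = E} {C′ = C′} {E′ = E′}
                       C⊆U C′⊆U B∌U B′∌U C′#D′ E′#B′ ≺CD ≺EB u∈ v∈ p
      with precedes-++⁻ C p
    ... | inj₁ q =
      let uC′ = inside u∈ (All.lookup C⊆U (proj₁ (precedes⇒∈ q)))
          vC′ = inside v∈ (All.lookup C⊆U (proj₂ (precedes⇒∈ q)))
      in precedes-++⁺ˡ
           (precedes-++⁻ˡ C′ C′#D′ vC′ (≺CD (∈-++⁺ˡ uC′) (∈-++⁺ˡ vC′) (precedes-++⁺ˡ q)))
      where
      inside : ∀ {z} → z ∈ C′ ++ _ → U z → z ∈ C′
      inside = ∈-++-inside C′ B′∌U
    ... | inj₂ (inj₁ (uC , vB)) =
      precedes-++⁺ (∈-++-inside C′ B′∌U u∈ (All.lookup C⊆U uC))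
                   (∈-++-outside C′ C′⊆U v∈ (All.lookup B∌U vB))
    ... | inj₂ (inj₂ q) =
      let uB′ = outside u∈ (All.lookup B∌U (proj₁ (precedes⇒∈ q)))
          vB′ = outside v∈ (All.lookup B∌U (proj₂ (precedes⇒∈ q)))
      in precedes-++⁺ʳ C′
           (precedes-++⁻ʳ E′ E′#B′ uB′ (≺EB (∈-++⁺ʳ E′ uB′) (∈-++⁺ʳ E′ vB′) (precedes-++⁺ʳ E q)))
      where
      outside : ∀ {z} → z ∈ C′ ++ _ → ¬ U z → z ∈ _
      outside = ∈-++-outside C′ C′⊆U

module WalkProperties (G : Graph) where
  open Graph G

  infixr 5 _++ʷ_
  _++ʷ_ : ∀ {x v y} → Walk G x v → Walk G v y → Walk G x y
  nil ++ʷ s = s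
  cons e j p ++ʷ s = cons e j (p ++ʷ s)

  tailVerts : ∀ {x y} → Walk G x y → List V
  tailVerts nil = []
  tailVerts (cons _ _ w) = verts G w

  verts≡∷tailVerts : ∀ {x y} (w : Walk G x y) → verts G w ≡ x ∷ tailVerts w
  verts≡∷tailVerts nil = refl
  verts≡∷tailVerts (cons _ _ _) = refl

  verts-++ʷ : ∀ {x v y} (p : Walk G x v) (s : Walk G v y) →
              verts G (p ++ʷ s) ≡ verts G p ++ tailVerts s
  verts-++ʷ nil s = verts≡∷tailVerts s
  verts-++ʷ (cons _ _ p) s = cong (_ ∷_) (verts-++ʷ p s)

  verts-++ʷ-suffix : ∀ {x v y} (p : Walk G x v) (s : Walk G v y) →
                     ∃[ xs ] verts G (p ++ʷ s) ≡ xs ++ verts G s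
  verts-++ʷ-suffix nil s = [] , refl
  verts-++ʷ-suffix {x} (cons _ _ p) s with xs , eq ← verts-++ʷ-suffix p s =
    x ∷ xs , cong (x ∷_) eq

  edges-++ʷ : ∀ {x v y} (p : Walk G x v) (s : Walk G v y) →
              edges G (p ++ʷ s) ≡ edges G p ++ edges G s
  edges-++ʷ nil s = refl
  edges-++ʷ (cons e _ p) s = cong (e ∷_) (edges-++ʷ p s)

  start∈verts : ∀ {x y} (w : Walk G x y) → x ∈ verts G w
  start∈verts nil = here refl
  start∈verts (cons _ _ _) = here refl

  end∈verts : ∀ {x y} (w : Walk G x y) → y ∈ verts G w
  end∈verts nil = here refl
  end∈verts (cons _ _ w) = there (end∈verts w)

  ends∈verts : ∀ {x y e} (w : Walk G x y) → e ∈ edges G w →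
               end₁ e ∈ verts G w × end₂ e ∈ verts G w
  ends∈verts (cons _ (inj₁ (refl , refl)) w) (here refl) = here refl , there (start∈verts w)
  ends∈verts (cons _ (inj₂ (refl , refl)) w) (here refl) = there (start∈verts w) , here refl
  ends∈verts (cons _ _ w) (there e∈) with e₁∈ , e₂∈ ← ends∈verts w e∈ = there e₁∈ , there e₂∈

  end∈tailVerts : ∀ {x y e} (w : Walk G x y) → e ∈ edges G w →
                  end₁ e ∈ tailVerts w ⊎ end₂ e ∈ tailVerts w
  end∈tailVerts (cons _ (inj₁ (_ , refl)) w) (here refl) = inj₂ (start∈verts w)
  end∈tailVerts (cons _ (inj₂ (refl , _)) w) (here refl) = inj₁ (start∈verts w)
  end∈tailVerts (cons _ _ w) (there e∈) = inj₁ (proj₁ (ends∈verts w e∈))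

  separated⇒edges-disjoint : ∀ {ℓ} (U : V → Set ℓ) {x v y z} (p : Walk G x v) (s : Walk G y z) →
    All U (verts G p) → All (¬_ ∘ U) (tailVerts s) → ∀ e → e ∈ edges G p → e ∉ edges G s
  separated⇒edges-disjoint U p s p⊆U s∌U e e∈p e∈s with end∈tailVerts s e∈s
  ... | inj₁ e₁∈s = All.lookup s∌U e₁∈s (All.lookup p⊆U (proj₁ (ends∈verts p e∈p)))
  ... | inj₂ e₂∈s = All.lookup s∌U e₂∈s (All.lookup p⊆U (proj₂ (ends∈verts p e∈p)))

  splitAt : ∀ {x y v} (w : Walk G x y) → v ∈ verts G w →
            Σ (Walk G x v) λ p → Σ (Walk G v y) λ s → p ++ʷ s ≡ w
  splitAt nil (here refl) = nil , nil , refl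
  splitAt (cons e j w) (here refl) = nil , cons e j w , refl
  splitAt (cons e j w) (there v∈) with p , s , eq ← splitAt w v∈ =
    cons e j p , s , cong (cons e j) eq

  record LastSplit {ℓ} (U : V → Set ℓ) {x y} (w : Walk G x y) : Set ℓ where
    field
      {vertex} : V
      init     : Walk G x vertex
      rest     : Walk G vertex y
      split    : init ++ʷ rest ≡ w
      vertex∈U : U vertex
      rest∌U   : All (¬_ ∘ U) (tailVerts rest)

  splitAtLast : ∀ {ℓ} {U : V → Set ℓ} → Decidable U →
                ∀ {x y} (w : Walk G x y) → Any U (verts G w) → LastSplit U w
  splitAtLast U? nil (here Ux) =
    record { init = nil ; rest = nil ; split = refl ; vertex∈U = Ux ; rest∌U = [] }
  splitAtLast U? (cons e j w) U∈w with any? U? (verts G w) | U∈w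
  ... | yes U∈tail | _ = let open LastSplit (splitAtLast U? w U∈tail) in
    record { init = cons e j init ; rest = rest ; split = cong (cons e j) split
           ; vertex∈U = vertex∈U ; rest∌U = rest∌U }
  ... | no U∉tail | here Ux =
    record { init = nil ; rest = cons e j w ; split = refl
           ; vertex∈U = Ux ; rest∌U = ¬Any⇒All¬ _ U∉tail }
  ... | no U∉tail | there U∈tail = ⊥-elim (U∉tail U∈tail)

module PathProperties (G : Graph) where
  open Graph G

  orderCompatible-sym : ∀ {x y} {P P′ : Path G x y} →
                        OrderCompatible G P P′ → OrderCompatible G P′ P
  orderCompatible-sym compat u v u∈′ v∈′ u∈ v∈ = ⇔-sym (compat u v u∈ v∈ u∈′ v∈′)

  compatible⇒order-preserved : ∀ {x y} {P P′ : Path G x y} → OrderCompatible G P P′ →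
                               OrderPreserved (verts G (walk P)) (verts G (walk P′))
  compatible⇒order-preserved compat u∈′ v∈′ u≺v =
    let u∈ , v∈ = precedes⇒∈ u≺v in
    Equivalence.from precedes⇔precedesAt
      (Equivalence.to (compat _ _ u∈ v∈ u∈′ v∈′) (Equivalence.to precedes⇔precedesAt u≺v))

  order-preserved⇒compatible : ∀ {x y} {P P′ : Path G x y} →
    OrderPreserved (verts G (walk P)) (verts G (walk P′)) →
    OrderPreserved (verts G (walk P′)) (verts G (walk P)) → OrderCompatible G P P′
  order-preserved⇒compatible ≺⇒≺′ ≺′⇒≺ u v u∈ v∈ u∈′ v∈′ =
    mk⇔ (viaPrecedes (≺⇒≺′ u∈′ v∈′)) (viaPrecedes (≺′⇒≺ u∈ v∈))
    where
    viaPrecedes : ∀ {xs ys : List V} → (Precedes xs u v → Precedes ys u v) →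
                  PrecedesAt xs u v → PrecedesAt ys u v
    viaPrecedes f = Equivalence.to precedes⇔precedesAt ∘ f ∘ Equivalence.from precedes⇔precedesAt

module Gluing (G : Graph) {ℓ} (U : Graph.V G → Set ℓ) where
  open Graph G
  open WalkProperties G
  open PathProperties G
  open import Data.List.Relation.Binary.Disjoint.Propositional {A = V} using (Disjoint)

  record Junction {a b c} (P : Path G a b) (Q : Path G b c) : Set ℓ where
    field
      {vertex} : V
      P-init   : Walk G a vertex
      P-rest   : Walk G vertex b
      Q-init   : Walk G b vertex
      Q-rest   : Walk G vertex c
      P-split  : P-init ++ʷ P-rest ≡ walk P
      Q-split  : Q-init ++ʷ Q-rest ≡ walk Q
      P⊆U      : All U (verts G (walk P))
      Q-rest∌U : All (¬_ ∘ U) (tailVerts Q-rest)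

    P-verts : verts G (walk P) ≡ verts G P-init ++ tailVerts P-rest
    P-verts = trans (cong (verts G) (sym P-split)) (verts-++ʷ P-init P-rest)

    Q-verts : verts G (walk Q) ≡ verts G Q-init ++ tailVerts Q-rest
    Q-verts = trans (cong (verts G) (sym Q-split)) (verts-++ʷ Q-init Q-rest)

    P-init⊆U : All U (verts G P-init)
    P-init⊆U = All.++⁻ˡ _ (subst (All U) P-verts P⊆U)

    P-unique : Unique (verts G P-init) × Unique (tailVerts P-rest) ×
               Disjoint (verts G P-init) (tailVerts P-rest)
    P-unique = unique-++⁻ _ (subst Unique P-verts (distinct P))

    Q-unique : Unique (verts G Q-init) × Unique (tailVerts Q-rest) ×
               Disjoint (verts G Q-init) (tailVerts Q-rest)
    Q-unique = unique-++⁻ _ (subst Unique Q-verts (distinct Q))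

    P-init-edges : ∀ {e} → e ∈ edges G P-init → e ∈ edges G (walk P)
    P-init-edges {e} e∈ = subst (λ w → e ∈ edges G w) P-split
      (subst (e ∈_) (sym (edges-++ʷ P-init P-rest)) (∈-++⁺ˡ e∈))

    Q-rest-edges : ∀ {e} → e ∈ edges G Q-rest → e ∈ edges G (walk Q)
    Q-rest-edges {e} e∈ = subst (λ w → e ∈ edges G w) Q-split
      (subst (e ∈_) (sym (edges-++ʷ Q-init Q-rest)) (∈-++⁺ʳ _ e∈))

    glued : Path G a c
    glued = mkPath (P-init ++ʷ Q-rest)
      (subst Unique (sym (verts-++ʷ P-init Q-rest))
        (Unique.++⁺ (proj₁ P-unique) (proj₁ (proj₂ Q-unique))
          λ (z∈P , z∈Q) → All.lookup Q-rest∌U z∈Q (All.lookup P-init⊆U z∈P)))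

    glued-verts : verts G (walk glued) ≡ verts G P-init ++ tailVerts Q-rest
    glued-verts = verts-++ʷ P-init Q-rest

    glued-edges : edges G (walk glued) ≡ edges G P-init ++ edges G Q-rest
    glued-edges = edges-++ʷ P-init Q-rest

    Q-verts-around-vertex : ∃[ xs ] verts G (walk Q) ≡ xs ++ vertex ∷ tailVerts Q-rest
    Q-verts-around-vertex with xs , eq ← verts-++ʷ-suffix Q-init Q-rest =
      xs , trans (cong (verts G) (sym Q-split))
                 (trans eq (cong (xs ++_) (verts≡∷tailVerts Q-rest)))

    vertex∈Q : vertex ∈ verts G (walk Q)
    vertex∈Q with xs , eq ← Q-verts-around-vertex =
      subst (vertex ∈_) (sym eq) (∈-++⁺ʳ xs (here refl))

    after-vertex∌U : ∀ {w} → Precedes (verts G (walk Q)) vertex w → ¬ U w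
    after-vertex∌U {w} v≺w with xs , eq ← Q-verts-around-vertex =
      All.lookup Q-rest∌U
        (precedes-after xs (subst Unique eq (distinct Q))
                           (subst (λ l → Precedes l vertex w) eq v≺w))

  open Junction

  module _ {a b c} {P P′ : Path G a b} {Q Q′ : Path G b c}
           (J : Junction P Q) (J′ : Junction P′ Q′) where

    glued-edgeDisjoint : EdgeDisjoint G P P′ → EdgeDisjoint G Q Q′ →
                         EdgeDisjoint G (glued J) (glued J′)
    glued-edgeDisjoint P#P′ Q#Q′ e e∈ e∈′
      with ∈-++⁻ (edges G (P-init J)) (subst (e ∈_) (glued-edges J) e∈)
         | ∈-++⁻ (edges G (P-init J′)) (subst (e ∈_) (glued-edges J′) e∈′)
    ... | inj₁ e∈P | inj₁ e∈P′ = P#P′ e (P-init-edges J e∈P) (P-init-edges J′ e∈P′)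
    ... | inj₂ e∈Q | inj₂ e∈Q′ = Q#Q′ e (Q-rest-edges J e∈Q) (Q-rest-edges J′ e∈Q′)
    ... | inj₁ e∈P | inj₂ e∈Q′ =
      separated⇒edges-disjoint U (P-init J) (Q-rest J′) (P-init⊆U J) (Q-rest∌U J′) e e∈P e∈Q′
    ... | inj₂ e∈Q | inj₁ e∈P′ =
      separated⇒edges-disjoint U (P-init J′) (Q-rest J) (P-init⊆U J′) (Q-rest∌U J) e e∈P′ e∈Q

    glued-order-preserved : OrderCompatible G P P′ → OrderCompatible G Q Q′ →
                            OrderPreserved (verts G (walk (glued J))) (verts G (walk (glued J′)))
    glued-order-preserved P∼P′ Q∼Q′ =
      subst₂ OrderPreserved (sym (glued-verts J)) (sym (glued-verts J′))
        (order-preserved-++ U (P-init⊆U J) (P-init⊆U J′) (Q-rest∌U J) (Q-rest∌U J′)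
          (proj₂ (proj₂ (P-unique J′))) (proj₂ (proj₂ (Q-unique J′)))
          (subst₂ OrderPreserved (P-verts J) (P-verts J′)
            (compatible⇒order-preserved {P = P} {P′} P∼P′))
          (subst₂ OrderPreserved (Q-verts J) (Q-verts J′)
            (compatible⇒order-preserved {P = Q} {Q′} Q∼Q′)))

  glued-orderCompatible : ∀ {a b c} {P P′ : Path G a b} {Q Q′ : Path G b c}
    (J : Junction P Q) (J′ : Junction P′ Q′) →
    OrderCompatible G P P′ → OrderCompatible G Q Q′ → OrderCompatible G (glued J) (glued J′)
  glued-orderCompatible {P = P} {P′} {Q} {Q′} J J′ P∼P′ Q∼Q′ =
    order-preserved⇒compatible {P = glued J} {glued J′}
      (glued-order-preserved J J′ P∼P′ Q∼Q′)
      (glued-order-preserved J′ J (orderCompatible-sym {P = P} {P′} P∼P′)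
                                  (orderCompatible-sym {P = Q} {Q′} Q∼Q′))

Eventually : ∀ {ℓ} → (ℕ → Set ℓ) → Set ℓ
Eventually P = ∃[ N ] (∀ j → N ≤ j → P j)

eventually-All : ∀ {a ℓ} {A : Set a} {P : A → ℕ → Set ℓ} xs →
                 All (λ x → Eventually (P x)) xs → Eventually (λ j → All (λ x → P x j) xs)
eventually-All [] [] = 0 , λ _ _ → []
eventually-All (x ∷ xs) ((N , later) ∷ laters) with M , later′ ← eventually-All xs laters =
  N ⊔ M , λ j N⊔M≤j → later j (m⊔n≤o⇒m≤o N M N⊔M≤j) ∷ later′ j (m⊔n≤o⇒n≤o N M N⊔M≤j)

infinite⊎eventually-absent : ExcludedMiddle 0ℓ → (R : ℕ → Set) →
                             Infinite R ⊎ Eventually (¬_ ∘ R)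
infinite⊎eventually-absent lem R with lem {Eventually (¬_ ∘ R)}
... | yes absent = inj₂ absent
... | no ¬absent = inj₁ witness
  where
  witness : ∀ n → ∃[ m ] (n ≤ m × R m)
  witness n with lem {∃[ m ] (n ≤ m × R m)}
  ... | yes found = found
  ... | no none = ⊥-elim (¬absent (n , λ m n≤m Rm → none (m , n≤m , Rm)))

step-monotone : (f : ℕ → ℕ) → (∀ k → f k ≤ f (suc k)) → ∀ {k l} → k ≤ l → f k ≤ f l
step-monotone f step k≤l = go (≤⇒≤′ k≤l)
  where
  go : ∀ {k l} → k ≤′ l → f k ≤ f l
  go ≤′-refl = ≤-refl
  go (≤′-step k≤′l) = ≤-trans (go k≤′l) (step _)

module AvoidingSubsequence {A : Set} {T : ℕ → Set} (infT : Infinite T) (f : ℕ → A)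
  (finite-fibres : ∀ x → Eventually (λ j → T j → f j ≢ x)) (L : ℕ → List A) where

  avoids : ∀ j → Eventually (λ i → T i → f i ∉ L j)
  avoids j with N , later ← eventually-All (L j) (All.tabulate λ {x} _ → finite-fibres x) =
    N , λ i N≤i Ti → All¬⇒¬Any (All.map (λ f≢ → f≢ Ti) (later i N≤i))

  -- pick (suc k) is chosen beyond pick k and beyond the point from which f avoids L (pick k).
  threshold : ℕ → ℕ
  pick : ℕ → ℕ
  pick k = proj₁ (infT (threshold k))
  threshold zero = 0
  threshold (suc k) = suc (pick k) ⊔ proj₁ (avoids (pick k))

  pick∈T : ∀ k → T (pick k)
  pick∈T k = proj₂ (proj₂ (infT (threshold k)))

  threshold≤pick : ∀ k → threshold k ≤ pick k
  threshold≤pick k = proj₁ (proj₂ (infT (threshold k)))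

  pick-step : ∀ k → pick k < pick (suc k)
  pick-step k =
    ≤-trans (m≤m⊔n (suc (pick k)) (proj₁ (avoids (pick k)))) (threshold≤pick (suc k))

  pick-monotone : ∀ {k l} → k ≤ l → pick k ≤ pick l
  pick-monotone = step-monotone pick (λ k → <⇒≤ (pick-step k))

  pick-< : ∀ {k l} → k < l → pick k < pick l
  pick-< {k} k<l = ≤-trans (pick-step k) (pick-monotone k<l)

  pick-avoids : ∀ {k l} → k < l → f (pick l) ∉ L (pick k)
  pick-avoids {k} {l} k<l = proj₂ (avoids (pick k)) (pick l) N≤pick (pick∈T l)
    where
    N≤pick : proj₁ (avoids (pick k)) ≤ pick l
    N≤pick = ≤-trans (m≤n⊔m (suc (pick k)) _)
                     (≤-trans (threshold≤pick (suc k)) (pick-monotone k<l))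

module _ (lem : ExcludedMiddle 0ℓ) (G : Graph) {a b c : Graph.V G}
         (𝒫ab : GoodFamily G a b) (𝒫bc : GoodFamily G b c) (S T : ℕ → Set) where
  open Graph G
  open WalkProperties G

  OnS : V → Set
  OnS x = ∃[ i ] (S i × _on_ G x (path 𝒫ab i))

  open Gluing G OnS

  module _ (infS : Infinite S) where

    b-OnS : OnS b
    b-OnS = let i , _ , Si = infS 0 in i , Si , end∈verts (walk (path 𝒫ab i))

    lastOnS : ∀ j → LastSplit OnS (walk (path 𝒫bc j))
    lastOnS j = splitAtLast (λ _ → lem) _ (lose (start∈verts _) b-OnS)

    junctionVertex : ℕ → V
    junctionVertex j = LastSplit.vertex (lastOnS j)

    junctionIndex : ℕ → ℕ
    junctionIndex j = proj₁ (LastSplit.vertex∈U (lastOnS j))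

    junctionVertex∈P : ∀ j → junctionVertex j ∈ verts G (walk (path 𝒫ab (junctionIndex j)))
    junctionVertex∈P j = proj₂ (proj₂ (LastSplit.vertex∈U (lastOnS j)))

    junction : ∀ j → Junction (path 𝒫ab (junctionIndex j)) (path 𝒫bc j)
    junction j = record
      { P-init = proj₁ P-cut ; P-rest = proj₁ (proj₂ P-cut) ; P-split = proj₂ (proj₂ P-cut)
      ; Q-init = init ; Q-rest = rest ; Q-split = split
      ; P⊆U = All.tabulate λ z∈P → junctionIndex j , proj₁ (proj₂ vertex∈U) , z∈P
      ; Q-rest∌U = rest∌U }
      where
      open LastSplit (lastOnS j)
      P-cut = splitAt (walk (path 𝒫ab (junctionIndex j))) (junctionVertex∈P j)

    junctionVertex-terminal : ∀ {T′} x → ∃ T′ → (∀ j → T′ j → junctionVertex j ≡ x) →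
                              IsTerminal G 𝒫ab 𝒫bc S T′ x
    junctionVertex-terminal x (j , T′j) at-x =
        subst OnS (at-x j T′j) (LastSplit.vertex∈U (lastOnS j))
      , (λ j T′j → subst (_∈ verts G (walk (path 𝒫bc j))) (at-x j T′j)
                         (Junction.vertex∈Q (junction j)))
      , λ j T′j w x≺w → Junction.after-vertex∌U (junction j)
          (subst (λ v → Precedes _ v w) (sym (at-x j T′j))
                 (Equivalence.from precedes⇔precedesAt x≺w))

    module _ (infT : Infinite T)
             (no-terminal : ¬ (∃[ S' ] ∃[ T' ] (S' ⊆ᵢ S × T' ⊆ᵢ T × Infinite S' × Infinite T' ×
                                ∃[ v ] IsTerminal G 𝒫ab 𝒫bc S' T' v))) where

      finite-fibres : ∀ x → Eventually (λ j → T j → junctionVertex j ≢ x)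
      finite-fibres x with infinite⊎eventually-absent lem (λ j → T j × junctionVertex j ≡ x)
      ... | inj₁ infinite = ⊥-elim (no-terminal
            (S , _ , (λ _ Si → Si) , (λ _ → proj₁) , infS , infinite ,
             x , junctionVertex-terminal x (let j , _ , T′j = infinite 0 in j , T′j) (λ _ → proj₂)))
      ... | inj₂ (N , absent) = N , λ j N≤j Tj at-x → absent j N≤j (Tj , at-x)

      open AvoidingSubsequence infT junctionVertex finite-fibres
             (λ j → verts G (walk (path 𝒫ab (junctionIndex j))))

      PicksDistinct : ℕ → ℕ → Set
      PicksDistinct k l = junctionIndex (pick k) ≢ junctionIndex (pick l) × pick k ≢ pick l

      picks-distinct-< : ∀ {k l} → k < l → PicksDistinct k l
      picks-distinct-< {k} {l} k<l = same-index-absurd , <⇒≢ (pick-< k<l)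
        where
        same-index-absurd : junctionIndex (pick k) ≢ junctionIndex (pick l)
        same-index-absurd same = pick-avoids k<l
          (subst (λ i → junctionVertex (pick l) ∈ verts G (walk (path 𝒫ab i)))
                 (sym same) (junctionVertex∈P (pick l)))

      picks-distinct : ∀ {k l} → k ≢ l → PicksDistinct k l
      picks-distinct {k} {l} k≢l with <-cmp k l
      ... | tri< k<l _ _ = picks-distinct-< k<l
      ... | tri≈ _ k≡l _ = ⊥-elim (k≢l k≡l)
      ... | tri> _ _ l<k = let i≢ , j≢ = picks-distinct-< l<k in ≢-sym i≢ , ≢-sym j≢

      gluedFamily : GoodFamily G a c
      gluedFamily = record
        { path = λ k → Junction.glued (junction (pick k))
        ; disj = λ k l k≢l → let i≢ , j≢ = picks-distinct k≢l in
            glued-edgeDisjoint (junction (pick k)) (junction (pick l))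
                               (disj 𝒫ab _ _ i≢) (disj 𝒫bc _ _ j≢)
        ; compat = λ k l k≢l → let i≢ , j≢ = picks-distinct k≢l in
            glued-orderCompatible (junction (pick k)) (junction (pick l))
                                  (compat 𝒫ab _ _ i≢) (compat 𝒫bc _ _ j≢)
        }

lemma3p3 : (lem : ∀ {ℓ : Level} → ExcludedMiddle ℓ) →
    (G : Graph) → (a b c : Graph.V G) →
    a ≢ b → b ≢ c → a ≢ c →
    (𝒫ab : GoodFamily G a b) → (𝒫bc : GoodFamily G b c) →
    (S T : ℕ → Set) → Infinite S → Infinite T →
    ¬ (∃[ S' ] ∃[ T' ] (S' ⊆ᵢ S × T' ⊆ᵢ T × Infinite S' × Infinite T' ×
         ∃[ v ] IsTerminal G 𝒫ab 𝒫bc S' T' v)) →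
    GoodFamily G a c
lemma3p3 lem G a b c _ _ _ 𝒫ab 𝒫bc S T infS infT no-terminal =
  gluedFamily lem G 𝒫ab 𝒫bc S T infS infT no-terminal
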